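{- For every $n\ge1$, $\mathrm{Sort}_n(\mathfrak{s}_{3\underline{21}})=\mathrm{Av}_n(123,132)$.
   Context: A pattern is a permutation $\sigma$ in which some blocks of consecutive entries may be underlined; a sequence contains it if it has a subsequence order-isomorphic to $\sigma$ whose entries corresponding to a common underlined block are adjacent in the sequence. $\mathrm{Av}_n(\dots)$ is the set of $\tau\in\mathfrak S_n$ avoiding all listed patterns (here classical). Pattern-avoiding stack map $\mathfrak{s}_\sigma$: process input $\tau_1,\dots,\tau_n$ in order; when $\tau_i$ is next, while the stack is nonempty and the sequence formed by placing $\tau_i$ on top of the stack, read top to bottom, contains $\sigma$ (underlined entries adjacent in the stack), pop the top entry to the output; then push $\tau_i$; at the end pop all remaining entries top to bottom to the output. West's stack-sorting map $s$ pushes each input entry after popping all smaller stack entries to the output, emptying the stack at the end. $\mathrm{Sort}_n(\mathfrak{s}_\sigma)=\{\tau\in\mathfrak S_n: s(\mathfrak{s}_\sigma(\tau))=12\cdots n\}$. -}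

module Defs where

open import Data.Nat using (ℕ; zero; suc; _<_; _<?_)
open import Data.Fin using (Fin; toℕ)
import Data.Fin as F
open import Data.List using (List; []; _∷_; _++_; length; lookup; map; upTo)
open import Data.List.Membership.Propositional using (_∈_)
open import Data.List.Relation.Binary.Permutation.Propositional using (_↭_)
open import Data.Product using (Σ; _×_; _,_)
open import Relation.Nullary using (¬_; Dec; yes; no)
open import Relation.Binary.PropositionalEquality using (_≡_)
open import Function.Bundles using (_⇔_)

-- A pattern: a permutation (one-line notation, values 1..k) together with
-- the list of positions j (0-based) such that entries j and j+1 of the
-- pattern lie in a common underlined block (hence must be adjacent).
record Pattern : Set where
  constructor pat
  field
    perm : List ℕ
    underlinedAdj : List ℕ
open Pattern public

record Occurrence (xs : List ℕ) (p : Pattern) : Set where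
  field
    f : Fin (length (perm p)) → Fin (length xs)
    increasing : ∀ a b → a F.< b → f a F.< f b
    orderIso : ∀ a b →
      (lookup (perm p) a < lookup (perm p) b) ⇔ (lookup xs (f a) < lookup xs (f b))
    adjacent : ∀ a b → suc (toℕ a) ≡ toℕ b → toℕ a ∈ underlinedAdj p →
      toℕ (f b) ≡ suc (toℕ (f a))

Contains : List ℕ → Pattern → Set
Contains xs p = Occurrence xs p

Avoids : List ℕ → Pattern → Set
Avoids xs p = ¬ Contains xs p

classical : List ℕ → Pattern
classical π = pat π []

-- the pattern 3 \underline{21}: entries at positions 1 and 2 adjacent
p3-21 : Pattern
p3-21 = pat (3 ∷ 2 ∷ 1 ∷ []) (1 ∷ [])

identity : ℕ → List ℕ
identity n = map suc (upTo n)

IsPerm : ℕ → List ℕ → Set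
IsPerm n τ = τ ↭ identity n

-- Generic stack step: given a decision on whether to pop when x is the next
-- input and the stack (top first) is y ∷ st, pop repeatedly; returns the new
-- stack (with x pushed) and the popped entries in output order.
module StackStep (popWhen : ℕ → List ℕ → Set)
                 (popWhen? : ∀ x st → Dec (popWhen x st)) where
  step : ℕ → List ℕ → List ℕ × List ℕ
  step x [] = (x ∷ [] , [])
  step x (y ∷ st) with popWhen? x (y ∷ st)
  ... | no _ = (x ∷ y ∷ st , [])
  ... | yes _ with step x st
  ...   | (st' , out) = (st' , y ∷ out)

  run : List ℕ → List ℕ → List ℕ
  run stack [] = stack
  run stack (x ∷ xs) with step x stack
  ... | (st' , out) = out ++ run st' xs

  stackMap : List ℕ → List ℕ
  stackMap τ = run [] τ

-- Pattern-avoiding stack map s_σ, parametrised by a decision procedure for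
-- containment of σ (the result does not depend on which one is used).
patternStackMap : (σ : Pattern) → (∀ xs → Dec (Contains xs σ)) → List ℕ → List ℕ
patternStackMap σ d = StackStep.stackMap (λ x st → Contains (x ∷ st) σ) (λ x st → d (x ∷ st))

westPop : ℕ → List ℕ → Set
westPop x [] = Data.Nat._<_ x x
westPop x (y ∷ st) = y < x

westPop? : ∀ x st → Dec (westPop x st)
westPop? x [] = x <? x
westPop? x (y ∷ st) = y <? x

westSort : List ℕ → List ℕ
westSort = StackStep.stackMap westPop westPop?

InSort : (σ : Pattern) → (∀ xs → Dec (Contains xs σ)) → ℕ → List ℕ → Set
InSort σ d n τ = IsPerm n τ × (westSort (patternStackMap σ d τ) ≡ identity n)

InAv123-132 : ℕ → List ℕ → Set
InAv123-132 n τ = IsPerm n τ × Avoids τ (classical (1 ∷ 2 ∷ 3 ∷ [])) × Avoids τ (classical (1 ∷ 3 ∷ 2 ∷ []))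

module Submission where

-- Split a permutation around its maximum, w = L m R (its decreasing binary tree).
-- West's map satisfies westSort (L m R) = westSort L · westSort R · m, so westSort w is
-- sorted iff w avoids 231.  For the 3-21-avoiding stack map s: if L m R avoids 123 and
-- 132, then L is decreasing with all its entries above those of R; L is pushed without
-- pops, m lands on top of reverse L and that block stays untouched while R is processed,
-- so s (L m R) = s R · m · reverse L, which avoids 231 by induction.  Conversely, if
-- s (L m R) avoids 231, so do its subsequences s L and s R, hence L and R avoid 123 and
-- 132 by induction and L is again pushed without pops.  When m arrives it pops nothing,
-- since the last popped entry would exceed an entry left below it and form a 231 with m;
-- what m sits on is ascending, so L is decreasing, and an entry of R above an entry of L
-- would form a 231 with m in s R · m · reverse L.

open import Defs
open import Data.Nat using (ℕ; suc; _≤_; _<_; _>_; z≤n; s≤s; _<?_; _≤?_)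
open import Data.Nat.Properties
  using ( <-trans; <-asym; <-irrefl; <-cmp; ≤-trans; <-≤-trans; <⇒≤; ≰⇒>; ≮⇒≥; ≤∧≢⇒<
        ; suc-injective; ≤-totalOrder )
open import Data.Fin using (Fin; toℕ; #_)
import Data.Fin as F
open import Data.List using (List; []; _∷_; _++_; length; lookup; reverse; _ʳ++_)
open import Data.List.Properties using (++-assoc; ++-identityʳ; unfold-reverse)
open import Data.List.Membership.Propositional using (_∈_)
open import Data.List.Membership.Propositional.Properties
  using (∈-lookup; ∈-++⁺ˡ; ∈-++⁺ʳ; ∈-++⁻)
open import Data.List.Relation.Unary.Any using (here; there)
open import Data.List.Relation.Unary.All as All using (All; []; _∷_)
import Data.List.Relation.Unary.All.Properties as All
open import Data.List.Relation.Unary.AllPairs using (AllPairs; []; _∷_)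
import Data.List.Relation.Unary.AllPairs.Properties as AllPairs
open import Data.List.Relation.Unary.Linked using (Linked; []; [-]; _∷_)
open import Data.List.Relation.Unary.Linked.Properties using (Linked⇒AllPairs)
open import Data.List.Relation.Unary.Unique.Propositional using (Unique)
import Data.List.Relation.Unary.Unique.Propositional.Properties as Unique
open import Data.List.Relation.Unary.Sorted.TotalOrder.Properties
  using (↗↭↗⇒≋; AllPairs⇒Sorted)
open import Data.List.Relation.Binary.Sublist.Propositional
  using (_⊆_; []; _∷_; _∷ʳ_; ⊆-refl; ⊆-reflexive; ⊆-trans; to∈; from∈)
import Data.List.Relation.Binary.Sublist.Propositional.Properties as Sublist
open import Data.List.Relation.Binary.Permutation.Propositional
  using ( _↭_; ↭-refl; ↭-sym; ↭-trans; ↭-prep; ↭-swap; ↭-reflexive; ↭⇒↭ₛ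
        ; module PermutationReasoning )
import Data.List.Relation.Binary.Permutation.Propositional.Properties as Perm
open import Data.List.Relation.Binary.Permutation.Setoid.Properties using (Unique-resp-↭)
open import Data.List.Relation.Binary.Equality.Propositional using (≋⇒≡)
open import Data.Product using (∃-syntax; Σ-syntax; _×_; _,_; proj₁; proj₂; swap)
open import Data.Sum using (_⊎_; inj₁; inj₂; [_,_]′)
open import Data.Empty using (⊥; ⊥-elim)
open import Function.Base using (id; const; _∘_)
open import Function.Bundles using (_⇔_; mk⇔; Equivalence)
open import Function.Construct.Composition using (_⇔-∘_)
open import Function.Construct.Symmetry using (⇔-sym)
open import Relation.Nullary using (¬_; Dec; yes; no)
open import Relation.Binary.Definitions using (tri<; tri≈; tri>)
open import Relation.Binary.PropositionalEquality
  using (_≡_; _≢_; refl; sym; trans; cong; subst; subst₂; setoid; module ≡-Reasoning)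

private
  variable
    A : Set
    a m p q u v x y : ℕ
    xs ys w st B P L R X Y : List ℕ

-- Patterns as subsequences

⊆-++⁻ : ∀ (xs : List A) {ys zs} → zs ⊆ xs ++ ys →
        ∃[ zs₁ ] ∃[ zs₂ ] zs ≡ zs₁ ++ zs₂ × zs₁ ⊆ xs × zs₂ ⊆ ys
⊆-++⁻ [] s = [] , _ , refl , [] , s
⊆-++⁻ (x ∷ xs) (.x ∷ʳ s) with ⊆-++⁻ xs s
... | zs₁ , zs₂ , refl , s₁ , s₂ = zs₁ , zs₂ , refl , x ∷ʳ s₁ , s₂
⊆-++⁻ (x ∷ xs) (refl ∷ s) with ⊆-++⁻ xs s
... | zs₁ , zs₂ , refl , s₁ , s₂ = x ∷ zs₁ , zs₂ , refl , refl ∷ s₁ , s₂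

AllPairs-resp-⊆ : ∀ {R : A → A → Set} {xs ys} → xs ⊆ ys → AllPairs R ys → AllPairs R xs
AllPairs-resp-⊆ [] [] = []
AllPairs-resp-⊆ (y ∷ʳ s) (_ ∷ rs) = AllPairs-resp-⊆ s rs
AllPairs-resp-⊆ (refl ∷ s) (r ∷ rs) = Sublist.All-resp-⊆ s r ∷ AllPairs-resp-⊆ s rs

AllPairs-pair : ∀ {R : A → A → Set} {x y xs} → AllPairs R xs → (x ∷ y ∷ []) ⊆ xs → R x y
AllPairs-pair rs s with AllPairs-resp-⊆ s rs
... | (r ∷ []) ∷ _ = r

reverse-∷-++ : ∀ (x : A) acc xs → reverse (x ∷ acc) ++ xs ≡ reverse acc ++ x ∷ xs
reverse-∷-++ x acc xs =
  trans (cong (_++ xs) (unfold-reverse x acc)) (++-assoc (reverse acc) (x ∷ []) xs)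

Sorted : List ℕ → Set
Sorted = AllPairs _≤_

HasPair : (ℕ → ℕ → Set) → List ℕ → Set
HasPair P w = ∃[ x ] ∃[ y ] (x ∷ y ∷ []) ⊆ w × P x y

HasTriple : (ℕ → ℕ → ℕ → Set) → List ℕ → Set
HasTriple P w = ∃[ x ] ∃[ y ] ∃[ z ] (x ∷ y ∷ z ∷ []) ⊆ w × P x y z

Ascent Descent : List ℕ → Set
Ascent = HasPair _<_
Descent = HasPair _>_

Is231 Is321 Is123or132 : ℕ → ℕ → ℕ → Set
Is231 b c a = a < b × b < c
Is321 c b a = b < c × a < b
Is123or132 a b c = a < b × a < c

Has231 Has123or132 : List ℕ → Set
Has231 = HasTriple Is231
Has123or132 = HasTriple Is123or132

Inversion : List ℕ → List ℕ → Set
Inversion X Y = ∃[ p ] ∃[ q ] p ∈ X × q ∈ Y × q < p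

hasPair-mono : ∀ {P} → xs ⊆ ys → HasPair P xs → HasPair P ys
hasPair-mono s (x , y , t , p) = x , y , ⊆-trans t s , p

hasTriple-mono : ∀ {P} → xs ⊆ ys → HasTriple P xs → HasTriple P ys
hasTriple-mono s (x , y , z , t , p) = x , y , z , ⊆-trans t s , p

¬hasTriple[] : ∀ {P} → ¬ HasTriple P []
¬hasTriple[] (_ , _ , _ , () , _)

ascent⇒descent-reverse : Ascent xs → Descent (reverse xs)
ascent⇒descent-reverse (a , b , s , a<b) = b , a , Sublist.reverse⁺ s , a<b

descent-reverse⇒ascent : Descent (reverse xs) → Ascent xs
descent-reverse⇒ascent (b , a , s , a<b) = a , b , Sublist.reverse⁻ {as = a ∷ b ∷ []} s , a<b

sorted⇒¬descent : Sorted xs → ¬ Descent xs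
sorted⇒¬descent sorted (b , a , s , a<b) =
  <-irrefl refl (<-≤-trans a<b (AllPairs-pair sorted s))

has231⇒descent : Has231 xs → Descent xs
has231⇒descent (b , c , a , s , a<b , _) = b , a , ⊆-trans (refl ∷ c ∷ʳ refl ∷ []) s , a<b

has231-split : All (_< m) X → All (_< m) Y → Has231 (X ++ m ∷ Y) →
               Has231 X ⊎ Has231 Y ⊎ Inversion X Y
has231-split {X = X} X<m Y<m (b , c , a , s , a<b , b<c) with ⊆-++⁻ X s
... | [] , _ , refl , _ , _ ∷ʳ s₂ = inj₂ (inj₁ (b , c , a , s₂ , a<b , b<c))
... | [] , _ , refl , _ , refl ∷ s₂ = ⊥-elim (<-asym b<c (All.lookup Y<m (to∈ s₂)))
... | _ ∷ [] , _ , refl , s₁ , s₂ = inj₂ (inj₂ (b , a , to∈ s₁ , to∈ (Sublist.∷⁻ s₂) , a<b))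
... | _ ∷ _ ∷ [] , _ , refl , s₁ , _ ∷ʳ s₂ = inj₂ (inj₂ (b , a , to∈ s₁ , to∈ s₂ , a<b))
... | _ ∷ _ ∷ [] , _ , refl , s₁ , refl ∷ _ = ⊥-elim (<-asym a<b (All.lookup X<m (to∈ s₁)))
... | _ ∷ _ ∷ _ ∷ [] , _ , refl , s₁ , _ = inj₁ (b , c , a , s₁ , a<b , b<c)

inversion⇒has231 : All (_< m) X → Inversion X Y → Has231 (X ++ m ∷ Y)
inversion⇒has231 X<m (p , q , p∈X , q∈Y , q<p) =
  p , _ , q , Sublist.++⁺ (from∈ p∈X) (refl ∷ from∈ q∈Y) , q<p , All.lookup X<m p∈X

has123or132-split : All (_< m) R → Has123or132 (L ++ m ∷ R) →
                    Ascent L ⊎ Inversion R L ⊎ Has123or132 R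
has123or132-split {L = L} R<m (a , b , c , s , a<b , a<c) with ⊆-++⁻ L s
... | [] , _ , refl , _ , _ ∷ʳ s₂ = inj₂ (inj₂ (a , b , c , s₂ , a<b , a<c))
... | [] , _ , refl , _ , refl ∷ s₂ = ⊥-elim (<-asym a<b (All.lookup R<m (to∈ s₂)))
... | _ ∷ [] , _ , refl , s₁ , s₂ = inj₂ (inj₁ (c , a , to∈ (Sublist.∷⁻ s₂) , to∈ s₁ , a<c))
... | _ ∷ _ ∷ [] , _ , refl , s₁ , _ = inj₁ (a , b , s₁ , a<b)
... | _ ∷ _ ∷ _ ∷ [] , _ , refl , s₁ , _ =
  inj₁ (a , b , ⊆-trans (refl ∷ refl ∷ c ∷ʳ []) s₁ , a<b)

ascent⇒has123or132 : All (_< m) L → Ascent L → Has123or132 (L ++ m ∷ R)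
ascent⇒has123or132 L<m (a , b , s , a<b) =
  a , b , _ , Sublist.++⁺ s (refl ∷ Sublist.[]⊆-universal _) , a<b , All.lookup L<m (to∈ s)

inversion⇒has123or132 : All (_< m) L → Inversion R L → Has123or132 (L ++ m ∷ R)
inversion⇒has123or132 L<m (c , a , c∈R , a∈L , a<c) =
  a , _ , c , Sublist.++⁺ (from∈ a∈L) (refl ∷ from∈ c∈R) , All.lookup L<m a∈L , a<c

-- Occurrences of patterns of length three

index : ∀ {xs ys : List A} → ys ⊆ xs → Fin (length ys) → Fin (length xs)
index (_ ∷ʳ s) i = F.suc (index s i)
index (refl ∷ s) F.zero = F.zero
index (refl ∷ s) (F.suc i) = F.suc (index s i)

lookup-index : ∀ {xs ys : List A} (s : ys ⊆ xs) i → lookup xs (index s i) ≡ lookup ys i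
lookup-index (_ ∷ʳ s) i = lookup-index s i
lookup-index (refl ∷ s) F.zero = refl
lookup-index (refl ∷ s) (F.suc i) = lookup-index s i

index-increasing : ∀ {xs ys : List A} (s : ys ⊆ xs) {i j} → i F.< j → index s i F.< index s j
index-increasing (_ ∷ʳ s) i<j = s≤s (index-increasing s i<j)
index-increasing (refl ∷ s) {F.zero} {F.suc j} _ = s≤s z≤n
index-increasing (refl ∷ s) {F.suc i} {F.suc j} (s≤s i<j) = s≤s (index-increasing s i<j)

lookup₂-⊆ : ∀ (xs : List A) {j k} → j F.< k → (lookup xs j ∷ lookup xs k ∷ []) ⊆ xs
lookup₂-⊆ (x ∷ xs) {F.zero} {F.suc k} _ = refl ∷ from∈ (∈-lookup k)
lookup₂-⊆ (x ∷ xs) {F.suc j} {F.suc k} (s≤s j<k) = x ∷ʳ lookup₂-⊆ xs j<k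

lookup₃-⊆ : ∀ (xs : List A) {i j k} → i F.< j → j F.< k →
            (lookup xs i ∷ lookup xs j ∷ lookup xs k ∷ []) ⊆ xs
lookup₃-⊆ (x ∷ xs) {F.zero} {F.suc j} {F.suc k} _ (s≤s j<k) = refl ∷ lookup₂-⊆ xs j<k
lookup₃-⊆ (x ∷ xs) {F.suc i} {F.suc j} {F.suc k} (s≤s i<j) (s≤s j<k) =
  x ∷ʳ lookup₃-⊆ xs i<j j<k

1<2 : 1 < 2
1<2 = s≤s (s≤s z≤n)

1<3 : 1 < 3
1<3 = s≤s (s≤s z≤n)

2<3 : 2 < 3
2<3 = s≤s (s≤s (s≤s z≤n))

SameOrder : ℕ → ℕ → ℕ → ℕ → Set
SameOrder p q u v = (p < q ⇔ u < v) × (q < p ⇔ v < u)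

sameOrder : p < q → u < v → SameOrder p q u v
sameOrder p<q u<v =
  mk⇔ (const u<v) (const p<q) , mk⇔ (⊥-elim ∘ <-asym p<q) (⊥-elim ∘ <-asym u<v)

<-irrefl-⇔ : p < p ⇔ u < u
<-irrefl-⇔ = mk⇔ (⊥-elim ∘ <-irrefl refl) (⊥-elim ∘ <-irrefl refl)

orderIso₃ : ∀ {p₀ p₁ p₂ x₀ x₁ x₂} →
            SameOrder p₀ p₁ x₀ x₁ → SameOrder p₀ p₂ x₀ x₂ → SameOrder p₁ p₂ x₁ x₂ →
            ∀ a b → (lookup (p₀ ∷ p₁ ∷ p₂ ∷ []) a < lookup (p₀ ∷ p₁ ∷ p₂ ∷ []) b)
                    ⇔ (lookup (x₀ ∷ x₁ ∷ x₂ ∷ []) a < lookup (x₀ ∷ x₁ ∷ x₂ ∷ []) b)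
orderIso₃ o₀₁ o₀₂ o₁₂ F.zero F.zero = <-irrefl-⇔
orderIso₃ o₀₁ o₀₂ o₁₂ F.zero (F.suc F.zero) = proj₁ o₀₁
orderIso₃ o₀₁ o₀₂ o₁₂ F.zero (F.suc (F.suc F.zero)) = proj₁ o₀₂
orderIso₃ o₀₁ o₀₂ o₁₂ (F.suc F.zero) F.zero = proj₂ o₀₁
orderIso₃ o₀₁ o₀₂ o₁₂ (F.suc F.zero) (F.suc F.zero) = <-irrefl-⇔
orderIso₃ o₀₁ o₀₂ o₁₂ (F.suc F.zero) (F.suc (F.suc F.zero)) = proj₁ o₁₂
orderIso₃ o₀₁ o₀₂ o₁₂ (F.suc (F.suc F.zero)) F.zero = proj₂ o₀₂
orderIso₃ o₀₁ o₀₂ o₁₂ (F.suc (F.suc F.zero)) (F.suc F.zero) = proj₂ o₁₂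
orderIso₃ o₀₁ o₀₂ o₁₂ (F.suc (F.suc F.zero)) (F.suc (F.suc F.zero)) = <-irrefl-⇔

AdjacentWhereUnderlined : ∀ {n} → List ℕ → (Fin 3 → Fin n) → Set
AdjacentWhereUnderlined u g =
  ∀ a b → suc (toℕ a) ≡ toℕ b → toℕ a ∈ u → toℕ (g b) ≡ suc (toℕ (g a))

noUnderlined : ∀ {n} (g : Fin 3 → Fin n) → AdjacentWhereUnderlined [] g
noUnderlined g _ _ _ ()

lastTwoAdjacent : ∀ {n} (g : Fin 3 → Fin n) → toℕ (g (# 2)) ≡ suc (toℕ (g (# 1))) →
                  AdjacentWhereUnderlined (1 ∷ []) g
lastTwoAdjacent g adj (F.suc F.zero) (F.suc (F.suc F.zero)) _ _ = adj
lastTwoAdjacent g adj F.zero _ _ (here ())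
lastTwoAdjacent g adj (F.suc F.zero) F.zero () _
lastTwoAdjacent g adj (F.suc F.zero) (F.suc F.zero) () _
lastTwoAdjacent g adj (F.suc (F.suc F.zero)) _ _ (here ())
lastTwoAdjacent g adj _ _ _ (there ())

occurrence₃ : ∀ {xs x₀ x₁ x₂ p₀ p₁ p₂ u} (s : (x₀ ∷ x₁ ∷ x₂ ∷ []) ⊆ xs) →
              SameOrder p₀ p₁ x₀ x₁ → SameOrder p₀ p₂ x₀ x₂ → SameOrder p₁ p₂ x₁ x₂ →
              AdjacentWhereUnderlined u (index s) → Occurrence xs (pat (p₀ ∷ p₁ ∷ p₂ ∷ []) u)
occurrence₃ {xs} {p₀ = p₀} {p₁} {p₂} s o₀₁ o₀₂ o₁₂ adj = record
  { f = index s
  ; increasing = λ _ _ → index-increasing s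
  ; orderIso = orderIso
  ; adjacent = adj
  }
  where
  π = p₀ ∷ p₁ ∷ p₂ ∷ []
  orderIso : ∀ a b → (lookup π a < lookup π b) ⇔ (lookup xs (index s a) < lookup xs (index s b))
  orderIso a b = subst₂ (λ x y → (lookup π a < lookup π b) ⇔ (x < y))
                        (sym (lookup-index s a)) (sym (lookup-index s b))
                        (orderIso₃ o₀₁ o₀₂ o₁₂ a b)

occurrence-∷ : ∀ {w σ} x → Occurrence w σ → Occurrence (x ∷ w) σ
occurrence-∷ x o = record
  { f = F.suc ∘ f
  ; increasing = λ a b → s≤s ∘ increasing a b
  ; orderIso = orderIso
  ; adjacent = λ a b a+1≡b a∈u → cong suc (adjacent a b a+1≡b a∈u)
  }
  where open Occurrence o

module _ {w p₀ p₁ p₂ u} (o : Occurrence w (pat (p₀ ∷ p₁ ∷ p₂ ∷ []) u)) where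
  open Occurrence o

  occurrence-⊆ : (lookup w (f (# 0)) ∷ lookup w (f (# 1)) ∷ lookup w (f (# 2)) ∷ []) ⊆ w
  occurrence-⊆ =
    lookup₃-⊆ w (increasing (# 0) (# 1) (s≤s z≤n)) (increasing (# 1) (# 2) (s≤s (s≤s z≤n)))

  occurrence-< : ∀ a b → lookup (p₀ ∷ p₁ ∷ p₂ ∷ []) a < lookup (p₀ ∷ p₁ ∷ p₂ ∷ []) b →
                         lookup w (f a) < lookup w (f b)
  occurrence-< a b = Equivalence.to (orderIso a b)

p123 p132 : Pattern
p123 = classical (1 ∷ 2 ∷ 3 ∷ [])
p132 = classical (1 ∷ 3 ∷ 2 ∷ [])

contains123⇒has123or132 : Contains w p123 → Has123or132 w
contains123⇒has123or132 o =
  _ , _ , _ , occurrence-⊆ o , occurrence-< o (# 0) (# 1) 1<2 , occurrence-< o (# 0) (# 2) 1<3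

contains132⇒has123or132 : Contains w p132 → Has123or132 w
contains132⇒has123or132 o =
  _ , _ , _ , occurrence-⊆ o , occurrence-< o (# 0) (# 1) 1<3 , occurrence-< o (# 0) (# 2) 1<2

has123or132⇒contains : Unique w → Has123or132 w → Contains w p123 ⊎ Contains w p132
has123or132⇒contains unique (a , b , c , s , a<b , a<c) with <-cmp b c
... | tri< b<c _ _ = inj₁ (occurrence₃ s (sameOrder 1<2 a<b) (sameOrder 1<3 a<c)
                                         (sameOrder 2<3 b<c) (noUnderlined _))
... | tri> _ _ c<b = inj₂ (occurrence₃ s (sameOrder 1<3 a<b) (sameOrder 1<2 a<c)
                                         (swap (sameOrder 2<3 c<b)) (noUnderlined _))
... | tri≈ _ b≡c _ with AllPairs-resp-⊆ s unique
...   | _ ∷ (b≢c ∷ []) ∷ _ = ⊥-elim (b≢c b≡c)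

avoids123and132⇔¬has123or132 : Unique w → (Avoids w p123 × Avoids w p132) ⇔ (¬ Has123or132 w)
avoids123and132⇔¬has123or132 unique = mk⇔
  (λ (¬123 , ¬132) → [ ¬123 , ¬132 ]′ ∘ has123or132⇒contains unique)
  (λ ¬bad → ¬bad ∘ contains123⇒has123or132 , ¬bad ∘ contains132⇒has123or132)

-- The pattern 3-21

data DescentBelow (u : ℕ) : List ℕ → Set where
  here  : ∀ {b c w} → b < u → c < b → DescentBelow u (b ∷ c ∷ w)
  there : ∀ {b w} → DescentBelow u w → DescentBelow u (b ∷ w)

data Has3-21 : List ℕ → Set where
  here  : ∀ {u w} → DescentBelow u w → Has3-21 (u ∷ w)
  there : ∀ {u w} → Has3-21 w → Has3-21 (u ∷ w)

AdjacentSublist : ℕ → ℕ → List ℕ → Set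
AdjacentSublist b c w =
  Σ[ s ∈ (b ∷ c ∷ []) ⊆ w ] toℕ (index s (# 1)) ≡ suc (toℕ (index s (# 0)))

descentBelow⇒adjacentSublist : DescentBelow u w →
                               ∃[ b ] ∃[ c ] AdjacentSublist b c w × b < u × c < b
descentBelow⇒adjacentSublist (here {w = w} b<u c<b) =
  _ , _ , (refl ∷ refl ∷ Sublist.[]⊆-universal w , refl) , b<u , c<b
descentBelow⇒adjacentSublist (there d) with descentBelow⇒adjacentSublist d
... | b , c , (s , adj) , b<u , c<b = b , c , (_ ∷ʳ s , cong suc adj) , b<u , c<b

has3-21⇒contains : Has3-21 w → Contains w p3-21
has3-21⇒contains (here d) with descentBelow⇒adjacentSublist d
... | b , c , (s , adj) , b<u , c<b =
  occurrence₃ (refl ∷ s) (swap (sameOrder 2<3 b<u)) (swap (sameOrder 1<3 (<-trans c<b b<u)))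
              (swap (sameOrder 1<2 c<b)) (lastTwoAdjacent (index (refl ∷ s)) (cong suc adj))
has3-21⇒contains (there h) = occurrence-∷ _ (has3-21⇒contains h)

positions⇒descentBelow : ∀ u w (j k : Fin (length w)) → toℕ k ≡ suc (toℕ j) →
                         lookup w j < u → lookup w k < lookup w j → DescentBelow u w
positions⇒descentBelow u (b ∷ c ∷ w) F.zero (F.suc F.zero) refl b<u c<b = here b<u c<b
positions⇒descentBelow u (b ∷ w) (F.suc j) (F.suc k) k≡j+1 b<u c<b =
  there (positions⇒descentBelow u w j k (suc-injective k≡j+1) b<u c<b)

positions⇒has3-21 : ∀ w (i j k : Fin (length w)) → i F.< j → toℕ k ≡ suc (toℕ j) →
                    lookup w j < lookup w i → lookup w k < lookup w j → Has3-21 w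
positions⇒has3-21 (u ∷ w) F.zero (F.suc j) (F.suc k) _ k≡j+1 b<u c<b =
  here (positions⇒descentBelow u w j k (suc-injective k≡j+1) b<u c<b)
positions⇒has3-21 (u ∷ w) (F.suc i) (F.suc j) (F.suc k) (s≤s i<j) k≡j+1 b<u c<b =
  there (positions⇒has3-21 w i j k i<j (suc-injective k≡j+1) b<u c<b)

contains⇒has3-21 : Contains w p3-21 → Has3-21 w
contains⇒has3-21 {w} o =
  positions⇒has3-21 w (f (# 0)) (f (# 1)) (f (# 2))
    (increasing (# 0) (# 1) (s≤s z≤n)) (adjacent (# 1) (# 2) refl (here refl))
    (Equivalence.to (orderIso (# 1) (# 0)) 2<3) (Equivalence.to (orderIso (# 2) (# 1)) 1<2)
  where open Occurrence o

descentBelow⇒descent : DescentBelow u w → Descent w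
descentBelow⇒descent (here {w = w} _ c<b) =
  _ , _ , refl ∷ refl ∷ Sublist.[]⊆-universal w , c<b
descentBelow⇒descent (there d) = hasPair-mono (_ ∷ʳ ⊆-refl) (descentBelow⇒descent d)

has3-21⇒descent : Has3-21 w → Descent w
has3-21⇒descent (here d) = hasPair-mono (_ ∷ʳ ⊆-refl) (descentBelow⇒descent d)
has3-21⇒descent (there h) = hasPair-mono (_ ∷ʳ ⊆-refl) (has3-21⇒descent h)

has3-21-∷⇒descent : Has3-21 (u ∷ w) → Descent w
has3-21-∷⇒descent (here d) = descentBelow⇒descent d
has3-21-∷⇒descent (there h) = has3-21⇒descent h

has3-21⇒has321 : Has3-21 w → HasTriple Is321 w
has3-21⇒has321 (here d) with descentBelow⇒adjacentSublist d
... | b , c , (s , _) , b<u , c<b = _ , b , c , refl ∷ s , b<u , c<b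
has3-21⇒has321 (there h) = hasTriple-mono (_ ∷ʳ ⊆-refl) (has3-21⇒has321 h)

has3-21⇒reverse-has123or132 : Has3-21 w → Has123or132 (reverse w)
has3-21⇒reverse-has123or132 h with has3-21⇒has321 h
... | u , b , c , s , b<u , c<b = c , b , u , Sublist.reverse⁺ s , c<b , <-trans c<b b<u

descentBelow-++ : ∀ v → DescentBelow u w → DescentBelow u (w ++ v)
descentBelow-++ v (here b<u c<b) = here b<u c<b
descentBelow-++ v (there d) = there (descentBelow-++ v d)

has3-21-++ : ∀ v → Has3-21 w → Has3-21 (w ++ v)
has3-21-++ v (here d) = here (descentBelow-++ v d)
has3-21-++ v (there h) = there (has3-21-++ v h)

descentBelow-above-floor : ∀ w → u < m → All (_< m) w → ¬ Descent B →
                           DescentBelow u (w ++ m ∷ B) → DescentBelow u w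
descentBelow-above-floor [] u<m _ _ (here m<u _) = ⊥-elim (<-asym u<m m<u)
descentBelow-above-floor [] _ _ ¬dB (there d) = ⊥-elim (¬dB (descentBelow⇒descent d))
descentBelow-above-floor (x ∷ []) _ (x<m ∷ _) _ (here _ m<x) = ⊥-elim (<-asym x<m m<x)
descentBelow-above-floor (x ∷ []) u<m _ _ (there (here m<u _)) = ⊥-elim (<-asym u<m m<u)
descentBelow-above-floor (x ∷ []) _ _ ¬dB (there (there d)) =
  ⊥-elim (¬dB (descentBelow⇒descent d))
descentBelow-above-floor (x ∷ x′ ∷ w) _ _ _ (here b<u c<b) = here b<u c<b
descentBelow-above-floor (x ∷ x′ ∷ w) u<m (_ ∷ w<m) ¬dB (there d) =
  there (descentBelow-above-floor (x′ ∷ w) u<m w<m ¬dB d)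

has3-21-above-floor : ∀ w → All (_< m) w → ¬ Descent B → Has3-21 (w ++ m ∷ B) → Has3-21 w
has3-21-above-floor [] _ ¬dB h = ⊥-elim (¬dB (has3-21-∷⇒descent h))
has3-21-above-floor (x ∷ w) (x<m ∷ w<m) ¬dB (here d) =
  here (descentBelow-above-floor w x<m w<m ¬dB d)
has3-21-above-floor (x ∷ w) (_ ∷ w<m) ¬dB (there h) = there (has3-21-above-floor w w<m ¬dB h)

¬has3-21-max∷⇒¬descent : All (_< m) B → ¬ Has3-21 (m ∷ B) → ¬ Descent B
¬has3-21-max∷⇒¬descent B<m ¬h = sorted⇒¬descent (Linked⇒AllPairs ≤-trans (linked B<m ¬h))
  where
  linked : ∀ {B} → All (_< m) B → ¬ Has3-21 (m ∷ B) → Linked _≤_ B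
  linked [] _ = []
  linked (_ ∷ []) _ = [-]
  linked {B = a ∷ b ∷ B} (a<m ∷ bB<m) ¬h with a ≤? b
  ... | yes a≤b = a≤b ∷ linked bB<m (¬h ∘ skip)
    where
    skip : Has3-21 (m ∷ b ∷ B) → Has3-21 (m ∷ a ∷ b ∷ B)
    skip (here d) = here (there d)
    skip (there h) = there (there h)
  ... | no a≰b = ⊥-elim (¬h (here (here a<m (≰⇒> a≰b))))

has3-21-∷-∷⇒exceeds-tail : ¬ Descent B → Has3-21 (m ∷ y ∷ B) → ∃[ b ] b ∈ B × b < y
has3-21-∷-∷⇒exceeds-tail _ (here (here _ c<y)) = _ , here refl , c<y
has3-21-∷-∷⇒exceeds-tail ¬dB (here (there d)) = ⊥-elim (¬dB (descentBelow⇒descent d))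
has3-21-∷-∷⇒exceeds-tail ¬dB (there h) = ⊥-elim (¬dB (has3-21-∷⇒descent h))

-- Decreasing binary trees

data DecreasingTree : List ℕ → Set where
  leaf : DecreasingTree []
  node : ∀ {L m R} → All (_< m) L → All (_< m) R → DecreasingTree L → DecreasingTree R →
         DecreasingTree (L ++ m ∷ R)

decreasingTree-∷ : All (a ≢_) xs → DecreasingTree xs → DecreasingTree (a ∷ xs)
decreasingTree-∷ _ leaf = node [] [] leaf leaf
decreasingTree-∷ {a} a≢ (node {L = L} {m = m} L<m R<m tL tR) with a <? m | All.++⁻ L a≢
... | yes a<m | a≢L , _ = node (a<m ∷ L<m) R<m (decreasingTree-∷ a≢L tL) tR
... | no a≮m | _ , a≢m ∷ _ =
  node [] (All.++⁺ (raise L<m) (m<a ∷ raise R<m)) leaf (node L<m R<m tL tR)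
  where
  m<a : m < a
  m<a = ≤∧≢⇒< (≮⇒≥ a≮m) (a≢m ∘ sym)
  raise : ∀ {zs} → All (_< m) zs → All (_< a) zs
  raise = All.map (λ x<m → <-trans x<m m<a)

unique-↭ : xs ↭ ys → Unique ys → Unique xs
unique-↭ xs↭ys = Unique-resp-↭ (setoid ℕ) (↭⇒↭ₛ (↭-sym xs↭ys))

decreasingTree : Unique xs → DecreasingTree xs
decreasingTree [] = leaf
decreasingTree (a≢ ∷ unique) = decreasingTree-∷ a≢ (decreasingTree unique)

-- Stack machines

module StackLemmas (popWhen : ℕ → List ℕ → Set) (popWhen? : ∀ x st → Dec (popWhen x st)) where
  open StackStep popWhen popWhen? public

  step-pop : ∀ {x y st} → popWhen x (y ∷ st) →
             step x (y ∷ st) ≡ (proj₁ (step x st) , y ∷ proj₂ (step x st))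
  step-pop {x} {y} {st} p with popWhen? x (y ∷ st)
  ... | no ¬p = ⊥-elim (¬p p)
  ... | yes _ with step x st
  ...   | _ = refl

  step-push : ∀ {x st} → ¬ popWhen x st → step x st ≡ (x ∷ st , [])
  step-push {st = []} _ = refl
  step-push {x} {y ∷ st} ¬p with popWhen? x (y ∷ st)
  ... | yes p = ⊥-elim (¬p p)
  ... | no _ = refl

  stackAfter : List ℕ → List ℕ → List ℕ
  stackAfter st [] = st
  stackAfter st (x ∷ xs) = stackAfter (proj₁ (step x st)) xs

  emitted : List ℕ → List ℕ → List ℕ
  emitted st [] = []
  emitted st (x ∷ xs) = proj₂ (step x st) ++ emitted (proj₁ (step x st)) xs

  run-∷ : ∀ st x xs → run st (x ∷ xs) ≡ proj₂ (step x st) ++ run (proj₁ (step x st)) xs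
  run-∷ st x xs with step x st
  ... | _ = refl

  run-++ : ∀ st xs ys → run st (xs ++ ys) ≡ emitted st xs ++ run (stackAfter st xs) ys
  run-++ st [] ys = refl
  run-++ st (x ∷ xs) ys = begin
    run st (x ∷ xs ++ ys)                                   ≡⟨ run-∷ st x (xs ++ ys) ⟩
    out ++ run st′ (xs ++ ys)                               ≡⟨ cong (out ++_) (run-++ st′ xs ys) ⟩
    out ++ emitted st′ xs ++ run (stackAfter st′ xs) ys     ≡⟨ ++-assoc out _ _ ⟨
    (out ++ emitted st′ xs) ++ run (stackAfter st′ xs) ys   ∎
    where
    open ≡-Reasoning
    st′ = proj₁ (step x st)
    out = proj₂ (step x st)

  run-split : ∀ st xs → run st xs ≡ emitted st xs ++ stackAfter st xs
  run-split st xs = begin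
    run st xs                          ≡⟨ cong (run st) (++-identityʳ xs) ⟨
    run st (xs ++ [])                  ≡⟨ run-++ st xs [] ⟩
    emitted st xs ++ stackAfter st xs  ∎
    where open ≡-Reasoning

  ↭-step : ∀ x st → proj₂ (step x st) ++ proj₁ (step x st) ↭ x ∷ st
  ↭-step x [] = ↭-refl
  ↭-step x (y ∷ st) with popWhen? x (y ∷ st)
  ... | no _ = ↭-refl
  ... | yes _ with step x st | ↭-step x st
  ...   | _ , _ | ↭₁ = ↭-trans (↭-prep y ↭₁) (↭-swap y x ↭-refl)

  run-↭ : ∀ st xs → run st xs ↭ st ++ xs
  run-↭ st [] = ↭-reflexive (sym (++-identityʳ st))
  run-↭ st (x ∷ xs) = begin
    run st (x ∷ xs)     ≡⟨ run-∷ st x xs ⟩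
    out ++ run st′ xs   ↭⟨ Perm.++⁺ˡ out (run-↭ st′ xs) ⟩
    out ++ st′ ++ xs    ≡⟨ ++-assoc out st′ xs ⟨
    (out ++ st′) ++ xs  ↭⟨ Perm.++⁺ʳ xs (↭-step x st) ⟩
    x ∷ st ++ xs        ↭⟨ Perm.shift x st xs ⟨
    st ++ x ∷ xs        ∎
    where
    open PermutationReasoning
    st′ = proj₁ (step x st)
    out = proj₂ (step x st)

  stackMap-↭ : ∀ xs → stackMap xs ↭ xs
  stackMap-↭ = run-↭ []

  All-step : ∀ {Q : ℕ → Set} → Q x → All Q st → All Q (proj₁ (step x st))
  All-step {x} {st} qx qst =
    All.++⁻ʳ (proj₂ (step x st)) (Perm.All-resp-↭ (↭-sym (↭-step x st)) (qx ∷ qst))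

  All-stackAfter : ∀ {Q : ℕ → Set} st xs → All Q st → All Q xs → All Q (stackAfter st xs)
  All-stackAfter st xs qst qxs = All.++⁻ʳ (emitted st xs) (Perm.All-resp-↭ ↭-run (All.++⁺ qst qxs))
    where
    ↭-run : st ++ xs ↭ emitted st xs ++ stackAfter st xs
    ↭-run = ↭-sym (↭-trans (↭-reflexive (sym (run-split st xs))) (run-↭ st xs))

  -- m ∷ B acts as a floor at the bottom of the stack: inputs smaller than m never pop it,
  -- and it does not affect whether the entries above it are popped.
  record IsFloor (m : ℕ) (B : List ℕ) : Set where
    field
      blocks : x < m → ¬ popWhen x (m ∷ B)
      transparent : All (_< m) (x ∷ y ∷ st) → popWhen x (y ∷ st ++ m ∷ B) ⇔ popWhen x (y ∷ st)

  step-floor : IsFloor m B → x < m → All (_< m) st →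
               step x (st ++ m ∷ B) ≡ (proj₁ (step x st) ++ m ∷ B , proj₂ (step x st))
  step-floor fl x<m [] = step-push (IsFloor.blocks fl x<m)
  step-floor {m} {B} {x} {y ∷ st} fl x<m (y<m ∷ st<m) = by-cases (popWhen? x (y ∷ st))
    where
    transparent = IsFloor.transparent fl (x<m ∷ y<m ∷ st<m)
    by-cases : Dec (popWhen x (y ∷ st)) →
               step x (y ∷ st ++ m ∷ B)
                 ≡ (proj₁ (step x (y ∷ st)) ++ m ∷ B , proj₂ (step x (y ∷ st)))
    by-cases (yes p)
      rewrite step-pop (Equivalence.from transparent p) | step-pop p | step-floor fl x<m st<m = refl
    by-cases (no ¬p)
      rewrite step-push (¬p ∘ Equivalence.to transparent) | step-push ¬p = refl

  run-floor : IsFloor m B → All (_< m) st → All (_< m) xs →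
              run (st ++ m ∷ B) xs ≡ run st xs ++ m ∷ B
  run-floor fl st<m [] = refl
  run-floor {m} {B} {st} {x ∷ xs} fl st<m (x<m ∷ xs<m) = begin
    run (st ++ m ∷ B) (x ∷ xs)
      ≡⟨ run-∷ (st ++ m ∷ B) x xs ⟩
    proj₂ (step x (st ++ m ∷ B)) ++ run (proj₁ (step x (st ++ m ∷ B))) xs
      ≡⟨ cong (λ r → proj₂ r ++ run (proj₁ r) xs) (step-floor fl x<m st<m) ⟩
    out ++ run (st′ ++ m ∷ B) xs
      ≡⟨ cong (out ++_) (run-floor fl (All-step x<m st<m) xs<m) ⟩
    out ++ run st′ xs ++ m ∷ B
      ≡⟨ ++-assoc out _ _ ⟨
    (out ++ run st′ xs) ++ m ∷ B
      ≡⟨ cong (_++ m ∷ B) (run-∷ st x xs) ⟨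
    run st (x ∷ xs) ++ m ∷ B
      ∎
    where
    open ≡-Reasoning
    st′ = proj₁ (step x st)
    out = proj₂ (step x st)

  stackMap-node : ∀ L → IsFloor m B → All (_< m) R → step m (stackAfter [] L) ≡ (m ∷ B , P) →
                  stackMap (L ++ m ∷ R) ≡ emitted [] L ++ P ++ stackMap R ++ m ∷ B
  stackMap-node {m} {B} {R} {P} L fl R<m step-m = begin
    run [] (L ++ m ∷ R)
      ≡⟨ run-++ [] L (m ∷ R) ⟩
    emitted [] L ++ run S (m ∷ R)
      ≡⟨ cong (emitted [] L ++_) (run-∷ S m R) ⟩
    emitted [] L ++ proj₂ (step m S) ++ run (proj₁ (step m S)) R
      ≡⟨ cong (λ r → emitted [] L ++ proj₂ r ++ run (proj₁ r) R) step-m ⟩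
    emitted [] L ++ P ++ run (m ∷ B) R
      ≡⟨ cong (λ r → emitted [] L ++ P ++ r) (run-floor fl [] R<m) ⟩
    emitted [] L ++ P ++ stackMap R ++ m ∷ B
      ∎
    where
    open ≡-Reasoning
    S = stackAfter [] L

-- West's stack-sorting map

module West = StackLemmas westPop westPop?

west-floor : West.IsFloor m []
west-floor = record { blocks = λ x<m m<x → <-asym x<m m<x ; transparent = λ _ → mk⇔ id id }

west-step-max : All (_< m) st → West.step m st ≡ (m ∷ [] , st)
west-step-max [] = refl
west-step-max {st = y ∷ st} (y<m ∷ st<m)
  rewrite West.step-pop {st = st} y<m | west-step-max st<m = refl

westSort-node : All (_< m) L → All (_< m) R →
                westSort (L ++ m ∷ R) ≡ westSort L ++ westSort R ++ m ∷ []
westSort-node {m} {L} {R} L<m R<m = begin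
  westSort (L ++ m ∷ R)               ≡⟨ West.stackMap-node L west-floor R<m step-m ⟩
  out ++ S ++ westSort R ++ m ∷ []     ≡⟨ ++-assoc out _ _ ⟨
  (out ++ S) ++ westSort R ++ m ∷ []   ≡⟨ cong (_++ westSort R ++ m ∷ []) (West.run-split [] L) ⟨
  westSort L ++ westSort R ++ m ∷ []   ∎
  where
  open ≡-Reasoning
  out = West.emitted [] L
  S = West.stackAfter [] L
  step-m = west-step-max (West.All-stackAfter [] L [] L<m)

∈-westSort⁺ : x ∈ w → x ∈ westSort w
∈-westSort⁺ = Perm.∈-resp-↭ (↭-sym (West.stackMap-↭ _))

∈-westSort⁻ : x ∈ westSort w → x ∈ w
∈-westSort⁻ = Perm.∈-resp-↭ (West.stackMap-↭ _)

sorted-westSort⇒¬has231 : DecreasingTree w → Sorted (westSort w) → ¬ Has231 w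
sorted-westSort⇒¬has231 leaf _ = ¬hasTriple[]
sorted-westSort⇒¬has231 (node {L} {m} {R} L<m R<m tL tR) sorted =
  [ ¬231L , [ ¬231R , ¬inversion ]′ ]′ ∘ has231-split L<m R<m
  where
  sorted′ : Sorted (westSort L ++ westSort R ++ m ∷ [])
  sorted′ = subst Sorted (westSort-node L<m R<m) sorted
  ¬231L : ¬ Has231 L
  ¬231L = sorted-westSort⇒¬has231 tL (AllPairs-resp-⊆ (Sublist.++⁺ʳ _ ⊆-refl) sorted′)
  ¬231R : ¬ Has231 R
  ¬231R = sorted-westSort⇒¬has231 tR
            (AllPairs-resp-⊆ (Sublist.++⁺ˡ (westSort L) (Sublist.++⁺ʳ _ ⊆-refl)) sorted′)
  ¬inversion : ¬ Inversion L R
  ¬inversion (p , q , p∈L , q∈R , q<p) =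
    <-irrefl refl (<-≤-trans q<p (AllPairs-pair sorted′ pq⊆))
    where
    pq⊆ : (p ∷ q ∷ []) ⊆ westSort L ++ westSort R ++ m ∷ []
    pq⊆ = Sublist.++⁺ (from∈ (∈-westSort⁺ p∈L))
                      (Sublist.++⁺ʳ _ (from∈ (∈-westSort⁺ q∈R)))

¬has231⇒sorted-westSort : DecreasingTree w → ¬ Has231 w → Sorted (westSort w)
¬has231⇒sorted-westSort leaf _ = []
¬has231⇒sorted-westSort (node {L} {m} {R} L<m R<m tL tR) ¬231 =
  subst Sorted (sym (westSort-node L<m R<m))
        (AllPairs.++⁺ sortedL (AllPairs.++⁺ sortedR ([] ∷ []) R≤m) L≤Rm)
  where
  sortedL = ¬has231⇒sorted-westSort tL (¬231 ∘ hasTriple-mono (Sublist.++⁺ʳ _ ⊆-refl))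
  sortedR = ¬has231⇒sorted-westSort tR (¬231 ∘ hasTriple-mono (Sublist.++⁺ˡ L (_ ∷ʳ ⊆-refl)))
  R≤m : All (λ q → All (q ≤_) (m ∷ [])) (westSort R)
  R≤m = All.tabulate λ q∈ → <⇒≤ (All.lookup R<m (∈-westSort⁻ q∈)) ∷ []
  below : ∀ {p q} → p ∈ westSort L → q ∈ westSort R ⊎ q ∈ m ∷ [] → p ≤ q
  below p∈ (inj₁ q∈) =
    ≮⇒≥ λ q<p → ¬231 (inversion⇒has231 L<m
                        (_ , _ , ∈-westSort⁻ p∈ , ∈-westSort⁻ q∈ , q<p))
  below p∈ (inj₂ (here refl)) = <⇒≤ (All.lookup L<m (∈-westSort⁻ p∈))
  L≤Rm : All (λ p → All (p ≤_) (westSort R ++ m ∷ [])) (westSort L)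
  L≤Rm = All.tabulate λ p∈ → All.tabulate λ q∈ → below p∈ (∈-++⁻ (westSort R) q∈)

-- The 3-21-avoiding stack map

module PatternStack (d : ∀ xs → Dec (Contains xs p3-21)) where
  open StackLemmas (λ x st → Contains (x ∷ st) p3-21) (λ x st → d (x ∷ st))

  s : List ℕ → List ℕ
  s = patternStackMap p3-21 d

  s-↭ : ∀ w → s w ↭ w
  s-↭ = stackMap-↭

  ∈-s⁺ : x ∈ w → x ∈ s w
  ∈-s⁺ = Perm.∈-resp-↭ (↭-sym (s-↭ _))

  ∈-s⁻ : x ∈ s w → x ∈ w
  ∈-s⁻ = Perm.∈-resp-↭ (s-↭ _)

  floor : ¬ Descent B → IsFloor m B
  floor {B} {m} ¬dB = record
    { blocks = λ x<m →
        ¬has3-21[x] ∘ has3-21-above-floor (_ ∷ []) (x<m ∷ []) ¬dB ∘ contains⇒has3-21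
    ; transparent = λ {x} {y} {st} xyst<m → mk⇔
        (has3-21⇒contains ∘ has3-21-above-floor (x ∷ y ∷ st) xyst<m ¬dB ∘ contains⇒has3-21)
        (has3-21⇒contains ∘ has3-21-++ (m ∷ B) ∘ contains⇒has3-21)
    }
    where
    ¬has3-21[x] : ¬ Has3-21 (x ∷ [])
    ¬has3-21[x] (here ())
    ¬has3-21[x] (there ())

  record MaxStep (m : ℕ) (S : List ℕ) : Set where
    field
      popped kept : List ℕ
      splits : S ≡ popped ++ kept
      step-max : step m S ≡ (m ∷ kept , popped)
      kept-ascending : ¬ Descent kept
      popped-exceeds : popped ≡ [] ⊎ Inversion popped kept

  maxStep : ∀ S → All (_< m) S → MaxStep m S
  maxStep [] [] = record
    { popped = [] ; kept = [] ; splits = refl ; step-max = refl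
    ; kept-ascending = λ { (_ , _ , () , _) } ; popped-exceeds = inj₁ refl
    }
  maxStep {m} (y ∷ st) (y<m ∷ st<m) = by-cases (d (m ∷ y ∷ st))
    where
    by-cases : Dec (Contains (m ∷ y ∷ st) p3-21) → MaxStep m (y ∷ st)
    by-cases (no ¬c) = record
      { popped = [] ; kept = y ∷ st ; splits = refl ; step-max = step-push ¬c
      ; kept-ascending = ¬has3-21-max∷⇒¬descent (y<m ∷ st<m) (¬c ∘ has3-21⇒contains)
      ; popped-exceeds = inj₁ refl
      }
    by-cases (yes c) = record
      { popped = y ∷ popped ; kept = kept ; splits = cong (y ∷_) splits
      ; step-max = trans (step-pop c) (cong (λ r → proj₁ r , y ∷ proj₂ r) step-max)
      ; kept-ascending = kept-ascending
      ; popped-exceeds = inj₂ ([ y-exceeds , there-exceeds ]′ popped-exceeds)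
      }
      where
      open MaxStep (maxStep st st<m)
      y-exceeds : popped ≡ [] → Inversion (y ∷ popped) kept
      y-exceeds popped≡[] with has3-21-∷-∷⇒exceeds-tail kept-ascending
        (subst (λ z → Has3-21 (m ∷ y ∷ z)) (trans splits (cong (_++ kept) popped≡[]))
               (contains⇒has3-21 c))
      ... | b , b∈ , b<y = y , b , here refl , b∈ , b<y
      there-exceeds : Inversion popped kept → Inversion (y ∷ popped) kept
      there-exceeds (p , b , p∈ , b∈ , b<p) = p , b , there p∈ , b∈ , b<p

  ¬has123or132⇒¬pop : ∀ acc xs → ¬ Has123or132 (reverse acc ++ x ∷ xs) →
                      ¬ Contains (x ∷ acc) p3-21
  ¬has123or132⇒¬pop {x} acc xs ¬bad =
    ¬bad ∘ hasTriple-mono reversed⊆ ∘ has3-21⇒reverse-has123or132 ∘ contains⇒has3-21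
    where
    reversed⊆ : reverse (x ∷ acc) ⊆ reverse acc ++ x ∷ xs
    reversed⊆ = subst (reverse (x ∷ acc) ⊆_) (reverse-∷-++ x acc xs) (Sublist.++⁺ʳ xs ⊆-refl)

  ¬has123or132⇒no-pops : ∀ acc xs → ¬ Has123or132 (reverse acc ++ xs) →
                         emitted acc xs ≡ [] × stackAfter acc xs ≡ xs ʳ++ acc
  ¬has123or132⇒no-pops acc [] _ = refl , refl
  ¬has123or132⇒no-pops acc (x ∷ xs) ¬bad rewrite step-push (¬has123or132⇒¬pop acc xs ¬bad) =
    ¬has123or132⇒no-pops (x ∷ acc) xs (¬bad ∘ hasTriple-mono (⊆-reflexive (reverse-∷-++ x acc xs)))

  s-node : All (_< m) R → ¬ Has123or132 L → ¬ Ascent L → s (L ++ m ∷ R) ≡ s R ++ m ∷ reverse L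
  s-node {m} {R} {L} R<m ¬bad ¬ascent = begin
    s (L ++ m ∷ R)                              ≡⟨ stackMap-node L (floor ¬descent) R<m step-m ⟩
    emitted [] L ++ [] ++ s R ++ m ∷ reverse L  ≡⟨ cong (_++ s R ++ m ∷ reverse L) emitted≡[] ⟩
    s R ++ m ∷ reverse L                        ∎
    where
    open ≡-Reasoning
    emitted≡[] = proj₁ (¬has123or132⇒no-pops [] L ¬bad)
    ¬descent : ¬ Descent (reverse L)
    ¬descent = ¬ascent ∘ descent-reverse⇒ascent
    step-m : step m (stackAfter [] L) ≡ (m ∷ reverse L , [])
    step-m rewrite proj₂ (¬has123or132⇒no-pops [] L ¬bad) =
      step-push (¬descent ∘ has3-21-∷⇒descent ∘ contains⇒has3-21)

  ¬has123or132⇒s-¬has231 : DecreasingTree w → ¬ Has123or132 w → ¬ Has231 (s w)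
  ¬has123or132⇒s-¬has231 leaf _ = ¬hasTriple[]
  ¬has123or132⇒s-¬has231 (node {L} {m} {R} L<m R<m _ tR) ¬bad =
    [ ¬231R , [ ¬231L , ¬inversion ]′ ]′ ∘ has231-split sR<m revL<m ∘ subst Has231 s-shape
    where
    ¬ascent : ¬ Ascent L
    ¬ascent = ¬bad ∘ ascent⇒has123or132 L<m
    s-shape : s (L ++ m ∷ R) ≡ s R ++ m ∷ reverse L
    s-shape = s-node R<m (¬bad ∘ hasTriple-mono (Sublist.++⁺ʳ (m ∷ R) ⊆-refl)) ¬ascent
    sR<m : All (_< m) (s R)
    sR<m = Perm.All-resp-↭ (↭-sym (s-↭ R)) R<m
    revL<m : All (_< m) (reverse L)
    revL<m = Perm.All-resp-↭ (↭-sym (Perm.↭-reverse L)) L<m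
    ¬231R : ¬ Has231 (s R)
    ¬231R = ¬has123or132⇒s-¬has231 tR (¬bad ∘ hasTriple-mono (Sublist.++⁺ˡ L (m ∷ʳ ⊆-refl)))
    ¬231L : ¬ Has231 (reverse L)
    ¬231L = ¬ascent ∘ descent-reverse⇒ascent ∘ has231⇒descent
    ¬inversion : ¬ Inversion (s R) (reverse L)
    ¬inversion (p , q , p∈ , q∈ , q<p) =
      ¬bad (inversion⇒has123or132 L<m
              (p , q , ∈-s⁻ p∈ , Perm.∈-resp-↭ (Perm.↭-reverse L) q∈ , q<p))

  s-¬has231⇒¬has123or132 : DecreasingTree w → ¬ Has231 (s w) → ¬ Has123or132 w
  s-¬has231⇒¬has123or132 leaf _ = ¬hasTriple[]
  s-¬has231⇒¬has123or132 (node {L} {m} {R} L<m R<m tL tR) ¬231 =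
    [ ¬ascent , [ ¬inversion , ¬badR ]′ ]′ ∘ has123or132-split R<m
    where
    S<m : All (_< m) (stackAfter [] L)
    S<m = All-stackAfter [] L [] L<m
    open MaxStep (maxStep (stackAfter [] L) S<m)
    ¬231′ : ¬ Has231 (emitted [] L ++ popped ++ s R ++ m ∷ kept)
    ¬231′ = ¬231 ∘ subst Has231 (sym (stackMap-node L (floor kept-ascending) R<m step-max))
    ¬231-across : ∀ {p q} → p ∈ popped ++ s R → q ∈ kept → q < p → p < m → ⊥
    ¬231-across p∈ q∈ q<p p<m = ¬231′ (_ , _ , _ , pmq⊆ , q<p , p<m)
      where
      pmq⊆ = Sublist.++⁺ˡ (emitted [] L)
               (subst (_ ⊆_) (++-assoc popped (s R) (m ∷ kept))
                      (Sublist.++⁺ (from∈ p∈) (refl ∷ from∈ q∈)))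
    ¬badR : ¬ Has123or132 R
    ¬badR = s-¬has231⇒¬has123or132 tR (¬231′ ∘ hasTriple-mono sR⊆)
      where
      sR⊆ = Sublist.++⁺ˡ (emitted [] L) (Sublist.++⁺ˡ popped (Sublist.++⁺ʳ (m ∷ kept) ⊆-refl))
    ¬badL : ¬ Has123or132 L
    ¬badL = s-¬has231⇒¬has123or132 tL (¬231′ ∘ hasTriple-mono sL⊆)
      where
      sL⊆ : s L ⊆ emitted [] L ++ popped ++ s R ++ m ∷ kept
      sL⊆ = subst (_⊆ emitted [] L ++ popped ++ s R ++ m ∷ kept)
                  (sym (trans (run-split [] L) (cong (emitted [] L ++_) splits)))
                  (Sublist.++⁺ (⊆-refl {x = emitted [] L})
                     (Sublist.++⁺ (⊆-refl {x = popped}) (Sublist.++⁺ˡ (s R) (m ∷ʳ ⊆-refl))))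
    popped≡[] : popped ≡ []
    popped≡[] = [ id , ⊥-elim ∘ ¬inverted ]′ popped-exceeds
      where
      ¬inverted : ¬ Inversion popped kept
      ¬inverted (p , q , p∈ , q∈ , q<p) =
        ¬231-across (∈-++⁺ˡ p∈) q∈ q<p
                    (All.lookup (subst (All (_< m)) splits S<m) (∈-++⁺ˡ p∈))
    kept≡reverse : kept ≡ reverse L
    kept≡reverse = begin
      kept             ≡⟨ cong (_++ kept) popped≡[] ⟨
      popped ++ kept   ≡⟨ splits ⟨
      stackAfter [] L  ≡⟨ proj₂ (¬has123or132⇒no-pops [] L ¬badL) ⟩
      reverse L        ∎
      where open ≡-Reasoning
    ¬ascent : ¬ Ascent L
    ¬ascent = kept-ascending ∘ subst Descent (sym kept≡reverse) ∘ ascent⇒descent-reverse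
    ¬inversion : ¬ Inversion R L
    ¬inversion (c , a , c∈R , a∈L , a<c) =
      ¬231-across (∈-++⁺ʳ popped (∈-s⁺ c∈R)) a∈kept a<c (All.lookup R<m c∈R)
      where
      a∈kept : a ∈ kept
      a∈kept = subst (a ∈_) (sym kept≡reverse) (Perm.∈-resp-↭ (↭-sym (Perm.↭-reverse L)) a∈L)

  sorted-westSort∘s⇔¬has123or132 : Unique w → Sorted (westSort (s w)) ⇔ (¬ Has123or132 w)
  sorted-westSort∘s⇔¬has123or132 {w} unique = mk⇔
    (s-¬has231⇒¬has123or132 tree ∘ sorted-westSort⇒¬has231 s-tree)
    (¬has231⇒sorted-westSort s-tree ∘ ¬has123or132⇒s-¬has231 tree)
    where
    tree = decreasingTree unique
    s-tree = decreasingTree (unique-↭ (s-↭ w) unique)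

-- Sorting to the identity

sorted-↭⇒≡ : Sorted xs → Sorted ys → xs ↭ ys → xs ≡ ys
sorted-↭⇒≡ sorted-xs sorted-ys xs↭ys =
  ≋⇒≡ (↗↭↗⇒≋ ≤-totalOrder (AllPairs⇒Sorted ≤-totalOrder sorted-xs)
                          (AllPairs⇒Sorted ≤-totalOrder sorted-ys) (↭⇒↭ₛ xs↭ys))

identity-unique : ∀ n → Unique (identity n)
identity-unique n = Unique.map⁺ suc-injective (Unique.upTo⁺ n)

identity-sorted : ∀ n → Sorted (identity n)
identity-sorted n = AllPairs.map⁺ (AllPairs.applyUpTo⁺₁ id n (λ i<j _ → s≤s (<⇒≤ i<j)))

≡identity⇔sorted : ∀ n → w ↭ identity n → (w ≡ identity n) ⇔ Sorted w
≡identity⇔sorted n w↭ = mk⇔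
  (λ w≡ → subst Sorted (sym w≡) (identity-sorted n))
  (λ sorted → sorted-↭⇒≡ sorted (identity-sorted n) w↭)

mainTheorem19 : (d : ∀ xs → Dec (Contains xs p3-21)) → (n : ℕ) → 1 ≤ n →
                  (τ : List ℕ) → InSort p3-21 d n τ ⇔ InAv123-132 n τ
mainTheorem19 d n _ τ = mk⇔
  (λ (τ↭ , sorts) → τ↭ , Equivalence.to (sorts⇔avoids τ↭) sorts)
  (λ (τ↭ , avoids) → τ↭ , Equivalence.from (sorts⇔avoids τ↭) avoids)
  where
  open PatternStack d
  sorts⇔avoids : τ ↭ identity n → (westSort (s τ) ≡ identity n) ⇔ (Avoids τ p123 × Avoids τ p132)
  sorts⇔avoids τ↭ =
    ⇔-sym (avoids123and132⇔¬has123or132 unique)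
      ⇔-∘ (sorted-westSort∘s⇔¬has123or132 unique ⇔-∘ ≡identity⇔sorted n westSort∘s↭)
    where
    unique = unique-↭ τ↭ (identity-unique n)
    westSort∘s↭ = ↭-trans (West.stackMap-↭ (s τ)) (↭-trans (s-↭ τ) τ↭)
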